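{- For all integers $N\ge 1$ and $n\ge 0$, $$\sum_{\substack{i_1+i_2+i_3=n\\ i_1,i_2,i_3\ge 0}}\binom{n}{i_1,i_2,i_3}E_{N,i_1}E_{N,i_2}E_{N,i_3}=\sum_{m=0}^n\sum_{k=0}^m\binom{n}{m}\binom{m}{k}\frac{(4N-m)(2N-k)}{8N^2}E_{N,k}\,\widehat E_{N-1,n-m}\,\widehat E_{N-1,m-k}.$$
   Context: $\binom{n}{i_1,i_2,i_3}=\frac{n!}{i_1!i_2!i_3!}$. For an integer $N\ge 0$, the hypergeometric Euler numbers $E_{N,n}$ are defined by $\dfrac{1}{\sum_{m\ge 0}\frac{(2N)!}{(2N+2m)!}t^{2m}}=\sum_{n=0}^\infty E_{N,n}\frac{t^n}{n!}$ (the denominator equals ${}_1F_2(1;N+1,\tfrac{2N+1}{2};\tfrac{t^2}{4})$). For an integer $M\ge 0$, the complementary hypergeometric Euler numbers $\widehat E_{M,n}$ are defined by $$\frac{t^{2M+1}/(2M+1)!}{\sinh t-\sum_{m=0}^{M-1}t^{2m+1}/(2m+1)!}=\sum_{n=0}^\infty\widehat E_{M,n}\frac{t^n}{n!},$$ equivalently $1/\sum_{m\ge0}\frac{(2M+1)!}{(2M+2m+1)!}t^{2m}=\sum_n\widehat E_{M,n}t^n/n!$. -}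

module Defs where

open import Data.Nat as ℕ using (ℕ; zero; suc; _∸_; _!)
open import Data.Nat.Properties using (_!≢0; m*n≢0)
open import Data.Nat.Combinatorics using (_C_)
open import Data.Integer as ℤ using (ℤ; +_)
open import Data.Rational using (ℚ; 0ℚ; 1ℚ; _+_; _*_; -_; _/_)
open import Data.List using (List; []; _∷_)
open import Data.Bool using (Bool; true; false; not; if_then_else_)


Σ[≤_] : ℕ → (ℕ → ℚ) → ℚ
Σ[≤ zero ] f = f 0
Σ[≤ suc n ] f = Σ[≤ n ] f + f (suc n)

-- Coefficients of the reciprocal 1/A(t) of a power series A(t) = Σ a k t^k
-- with a 0 = 1.  'invRev a n' is the list [b n , b (n-1) , … , b 0]
-- where Σ_n b n t^n = 1/A(t), determined by  Σ_{k=0}^{n} a k b (n-k) = δ_{n,0}.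
private
  dot : (ℕ → ℚ) → ℕ → List ℚ → ℚ
  dot a k []       = 0ℚ
  dot a k (x ∷ xs) = a k * x + dot a (suc k) xs

invRev : (ℕ → ℚ) → ℕ → List ℚ
invRev a zero    = 1ℚ ∷ []
invRev a (suc n) = (- dot a 1 (invRev a n)) ∷ invRev a n

private
  head0 : List ℚ → ℚ
  head0 []      = 0ℚ
  head0 (x ∷ _) = x

invCoeff : (ℕ → ℚ) → ℕ → ℚ
invCoeff a n = head0 (invRev a n)

isEven : ℕ → Bool
isEven zero = true
isEven (suc k) = not (isEven k)

hypSeries : ℕ → ℕ → ℚ
hypSeries d k =
  if isEven k
  then _/_ (+ (d !)) ((d ℕ.+ k) !) {{(d ℕ.+ k) !≢0}}
  else 0ℚ

-- Hypergeometric Euler numbers E_{N,n}: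
--   1 / Σ_{m≥0} (2N)!/(2N+2m)! t^{2m} = Σ_n E_{N,n} t^n / n!
E : ℕ → ℕ → ℚ
E N n = (+ (n !)) / 1 * invCoeff (hypSeries (2 ℕ.* N)) n

-- Complementary hypergeometric Euler numbers Ê_{M,n}:
--   1 / Σ_{m≥0} (2M+1)!/(2M+2m+1)! t^{2m} = Σ_n Ê_{M,n} t^n / n!
Ê : ℕ → ℕ → ℚ
Ê M n = (+ (n !)) / 1 * invCoeff (hypSeries (suc (2 ℕ.* M))) n

multinomial3 : ℕ → ℕ → ℕ → ℕ → ℚ
multinomial3 n i₁ i₂ i₃ =
  _/_ (+ (n !)) (i₁ ! ℕ.* i₂ ! ℕ.* i₃ !)
    {{m*n≢0 (i₁ ! ℕ.* i₂ !) (i₃ !) {{m*n≢0 (i₁ !) (i₂ !) {{i₁ !≢0}} {{i₂ !≢0}}}} {{i₃ !≢0}}}}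

binomQ : ℕ → ℕ → ℚ
binomQ n k = (+ (n C k)) / 1

weight : (N m k : ℕ) → .{{ℕ.NonZero N}} → ℚ
weight N m k =
  _/_ ((+ (4 ℕ.* N) ℤ.- + m) ℤ.* (+ (2 ℕ.* N) ℤ.- + k)) (8 ℕ.* (N ℕ.* N))
    {{m*n≢0 8 (N ℕ.* N) {{_}} {{m*n≢0 N N}}}}

-- With A = Σ_m (2N)!/(2N+2m)! t^{2m} and H the same series built from 2N − 1, the
-- numbers E_{N,n}/n! and Ê_{N−1,n}/n! are the coefficients of b = 1/A and c = 1/H, and
-- the Euler operator θ = t d/dt satisfies θA = 2N (H − A). Differentiating A b = 1 turns
-- this into (2N − θ) b = 2N H b², so ((2N − θ) b) c = 2N b²; applying 4N − θ and
-- multiplying by c once more gives ((4N − θ)(((2N − θ) b) c)) c = 8N² b³, a computation valid in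
-- any commutative ring with a derivation. As θ multiplies the n-th coefficient by n,
-- comparing n! times the n-th coefficients of both sides gives the theorem.

module Submission where

open import Defs
open import Data.Nat using (ℕ; _∸_; NonZero)
open import Data.Rational using (ℚ; _*_)
open import Relation.Binary.PropositionalEquality using (_≡_)
open import Data.Nat using (suc; _!)
open import Relation.Binary.PropositionalEquality using (cong; module ≡-Reasoning)
open import Algebra.Bundles using (CommutativeRing)
open import Level using (0ℓ)

module FiniteSums where

  open import Data.Nat as ℕ using (zero; suc; _≤_; z≤n)
  open import Data.Nat.Properties as ℕ using (≤-refl; m≤n⇒m≤1+n)
  open import Data.Rational using (0ℚ; _+_)
  open import Data.Rational.Properties
    using (+-identityʳ; +-comm; +-assoc; *-comm; *-distribˡ-+; +-*-commutativeRing)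
  open import Algebra.Properties.CommutativeSemigroup
    (CommutativeRing.+-commutativeSemigroup +-*-commutativeRing) using (interchange)
  open import Relation.Binary.PropositionalEquality
  open ≡-Reasoning

  Σ-cong-≤ : ∀ n {f g : ℕ → ℚ} → (∀ k → k ≤ n → f k ≡ g k) → Σ[≤ n ] f ≡ Σ[≤ n ] g
  Σ-cong-≤ zero    f≡g = f≡g 0 z≤n
  Σ-cong-≤ (suc n) f≡g =
    cong₂ _+_ (Σ-cong-≤ n (λ k k≤n → f≡g k (m≤n⇒m≤1+n k≤n))) (f≡g (suc n) ≤-refl)

  Σ-cong : ∀ n {f g : ℕ → ℚ} → f ≗ g → Σ[≤ n ] f ≡ Σ[≤ n ] g
  Σ-cong n f≗g = Σ-cong-≤ n (λ k _ → f≗g k)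

  Σ-zero : ∀ n → Σ[≤ n ] (λ _ → 0ℚ) ≡ 0ℚ
  Σ-zero zero    = refl
  Σ-zero (suc n) = trans (+-identityʳ _) (Σ-zero n)

  Σ-distrib-+ : ∀ n (f g : ℕ → ℚ) → Σ[≤ n ] (λ k → f k + g k) ≡ Σ[≤ n ] f + Σ[≤ n ] g
  Σ-distrib-+ zero    f g = refl
  Σ-distrib-+ (suc n) f g = trans (cong (_+ (f (suc n) + g (suc n))) (Σ-distrib-+ n f g))
                                  (interchange (Σ[≤ n ] f) (Σ[≤ n ] g) (f (suc n)) (g (suc n)))

  *-distribˡ-Σ : ∀ n c (f : ℕ → ℚ) → c * Σ[≤ n ] f ≡ Σ[≤ n ] (λ k → c * f k)
  *-distribˡ-Σ zero    c f = refl
  *-distribˡ-Σ (suc n) c f = trans (*-distribˡ-+ c (Σ[≤ n ] f) (f (suc n)))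
                                   (cong (_+ c * f (suc n)) (*-distribˡ-Σ n c f))

  *-distribʳ-Σ : ∀ n c (f : ℕ → ℚ) → Σ[≤ n ] f * c ≡ Σ[≤ n ] (λ k → f k * c)
  *-distribʳ-Σ n c f = trans (*-comm (Σ[≤ n ] f) c)
                             (trans (*-distribˡ-Σ n c f) (Σ-cong n (λ k → *-comm c (f k))))

  Σ-suc : ∀ n (f : ℕ → ℚ) → Σ[≤ suc n ] f ≡ f 0 + Σ[≤ n ] (λ k → f (suc k))
  Σ-suc zero    f = refl
  Σ-suc (suc n) f = trans (cong (_+ f (suc (suc n))) (Σ-suc n f)) (+-assoc (f 0) _ _)

  Σ-reverse : ∀ n (f : ℕ → ℚ) → Σ[≤ n ] f ≡ Σ[≤ n ] (λ k → f (n ∸ k))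
  Σ-reverse zero    f = refl
  Σ-reverse (suc n) f = begin
    Σ[≤ n ] f + f (suc n)                   ≡⟨ cong (_+ f (suc n)) (Σ-reverse n f) ⟩
    Σ[≤ n ] (λ k → f (n ∸ k)) + f (suc n)   ≡⟨ +-comm _ (f (suc n)) ⟩
    f (suc n) + Σ[≤ n ] (λ k → f (n ∸ k))   ≡⟨ Σ-suc n (λ k → f (suc n ∸ k)) ⟨
    Σ[≤ suc n ] (λ k → f (suc n ∸ k))       ∎

  Σ-triangle : ∀ n (F : ℕ → ℕ → ℚ) →
    Σ[≤ n ] (λ s → Σ[≤ s ] (λ i → F i s)) ≡ Σ[≤ n ] (λ i → Σ[≤ n ∸ i ] (λ j → F i (i ℕ.+ j)))
  Σ-triangle zero    F = refl
  Σ-triangle (suc n) F = begin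
    Σ[≤ n ] (λ s → Σ[≤ s ] (λ i → F i s)) + (Σ[≤ n ] (λ i → F i (suc n)) + F (suc n) (suc n))
      ≡⟨ cong (_+ Σ[≤ suc n ] (λ i → F i (suc n))) (Σ-triangle n F) ⟩
    Σ[≤ n ] rows + (Σ[≤ n ] (λ i → F i (suc n)) + F (suc n) (suc n))
      ≡⟨ +-assoc (Σ[≤ n ] rows) _ _ ⟨
    (Σ[≤ n ] rows + Σ[≤ n ] (λ i → F i (suc n))) + F (suc n) (suc n)
      ≡⟨ cong₂ _+_ (Σ-distrib-+ n rows (λ i → F i (suc n)))
                   (cong (F (suc n)) (ℕ.+-identityʳ (suc n))) ⟨
    Σ[≤ n ] (λ i → rows i + F i (suc n)) + F (suc n) (suc n ℕ.+ 0)
      ≡⟨ cong₂ _+_ (Σ-cong-≤ n (λ i i≤n → sym (extend-row i i≤n)))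
                   (cong (λ z → Σ[≤ z ] (λ j → F (suc n) (suc n ℕ.+ j))) (ℕ.n∸n≡0 n)) ⟨
    Σ[≤ suc n ] (λ i → Σ[≤ suc n ∸ i ] (λ j → F i (i ℕ.+ j))) ∎
    where
    rows : ℕ → ℚ
    rows i = Σ[≤ n ∸ i ] (λ j → F i (i ℕ.+ j))
    extend-row : ∀ i → i ≤ n → rows i + F i (suc n) ≡ Σ[≤ suc n ∸ i ] (λ j → F i (i ℕ.+ j))
    extend-row i i≤n rewrite ℕ.+-∸-assoc 1 i≤n =
      cong (rows i +_) (cong (F i) (sym (trans (ℕ.+-suc i (n ∸ i)) (cong suc (ℕ.m+[n∸m]≡n i≤n)))))

module IntegerEmbedding where

  open import Data.Nat as ℕ using (suc)
  open import Data.Nat.Properties as ℕ using (m*n≢0)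
  open import Data.Integer as ℤ using (ℤ; +_)
  open import Data.Integer.Properties as ℤ using (pos-+; pos-*)
  open import Data.Rational using (_+_; -_; _-_; _/_)
  open import Data.Rational.Properties
    using (*-comm; fromℚᵘ-cong; toℚᵘ-injective; toℚᵘ-fromℚᵘ; toℚᵘ-homo-*; toℚᵘ-homo-+; toℚᵘ-homo‿-)
  open import Data.Rational.Unnormalised as ℚᵘ using (mkℚᵘ; *≡*)
  open import Data.Rational.Unnormalised.Properties as ℚᵘ using (≃-trans; ≃-sym)
  open import Relation.Binary.PropositionalEquality

  fromℤ : ℤ → ℚ
  fromℤ i = i / 1

  fromℕ : ℕ → ℚ
  fromℕ n = fromℤ (+ n)

  i*n≡j*m⇒i/m≡j/n : ∀ i j m n .{{_ : NonZero m}} .{{_ : NonZero n}} →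
                    i ℤ.* + n ≡ j ℤ.* + m → i / m ≡ j / n
  i*n≡j*m⇒i/m≡j/n i j (suc m) (suc n) eq = fromℚᵘ-cong {mkℚᵘ i m} {mkℚᵘ j n} (*≡* eq)

  /-*-/ : ∀ i j m n .{{_ : NonZero m}} .{{_ : NonZero n}} →
          (i / m) * (j / n) ≡ ((i ℤ.* j) / (m ℕ.* n)) {{m*n≢0 m n}}
  /-*-/ i j (suc m) (suc n) = toℚᵘ-injective
    (≃-trans (toℚᵘ-homo-* (i / suc m) (j / suc n))
    (≃-trans (ℚᵘ.*-cong (toℚᵘ-fromℚᵘ (mkℚᵘ i m)) (toℚᵘ-fromℚᵘ (mkℚᵘ j n)))
             (≃-sym (toℚᵘ-fromℚᵘ (mkℚᵘ (i ℤ.* j) (n ℕ.+ m ℕ.* suc n))))))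

  /-+-/ : ∀ i j m n .{{_ : NonZero m}} .{{_ : NonZero n}} →
          (i / m) + (j / n) ≡ ((i ℤ.* + n ℤ.+ j ℤ.* + m) / (m ℕ.* n)) {{m*n≢0 m n}}
  /-+-/ i j (suc m) (suc n) = toℚᵘ-injective
    (≃-trans (toℚᵘ-homo-+ (i / suc m) (j / suc n))
    (≃-trans (ℚᵘ.+-cong (toℚᵘ-fromℚᵘ (mkℚᵘ i m)) (toℚᵘ-fromℚᵘ (mkℚᵘ j n)))
             (≃-sym (toℚᵘ-fromℚᵘ (mkℚᵘ (i ℤ.* + suc n ℤ.+ j ℤ.* + suc m) (n ℕ.+ m ℕ.* suc n))))))

  -‿/ : ∀ i m .{{_ : NonZero m}} → - (i / m) ≡ (ℤ.- i) / m
  -‿/ i (suc m) = toℚᵘ-injective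
    (≃-trans (toℚᵘ-homo‿- (i / suc m))
    (≃-trans (ℚᵘ.-‿cong (toℚᵘ-fromℚᵘ (mkℚᵘ i m)))
             (≃-sym (toℚᵘ-fromℚᵘ (mkℚᵘ (ℤ.- i) m)))))

  fromℤ-homo-* : ∀ i j → fromℤ (i ℤ.* j) ≡ fromℤ i * fromℤ j
  fromℤ-homo-* i j = sym (/-*-/ i j 1 1)

  fromℤ-homo-+ : ∀ i j → fromℤ (i ℤ.+ j) ≡ fromℤ i + fromℤ j
  fromℤ-homo-+ i j = sym (trans (/-+-/ i j 1 1)
    (cong₂ (λ x y → (x ℤ.+ y) / 1) (ℤ.*-identityʳ i) (ℤ.*-identityʳ j)))

  fromℤ-homo-- : ∀ i j → fromℤ (i ℤ.- j) ≡ fromℤ i - fromℤ j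
  fromℤ-homo-- i j = trans (fromℤ-homo-+ i (ℤ.- j)) (cong (λ q → fromℤ i + q) (sym (-‿/ j 1)))

  fromℕ-homo-+ : ∀ m n → fromℕ (m ℕ.+ n) ≡ fromℕ m + fromℕ n
  fromℕ-homo-+ m n = trans (cong fromℤ (pos-+ m n)) (fromℤ-homo-+ (+ m) (+ n))

  fromℕ-homo-* : ∀ m n → fromℕ (m ℕ.* n) ≡ fromℕ m * fromℕ n
  fromℕ-homo-* m n = trans (cong fromℤ (pos-* m n)) (fromℤ-homo-* (+ m) (+ n))

  fromℤ-*-/ : ∀ i j m .{{_ : NonZero m}} → fromℤ i * (j / m) ≡ (i ℤ.* j) / m
  fromℤ-*-/ i j m = trans (/-*-/ i j 1 m)
    (i*n≡j*m⇒i/m≡j/n (i ℤ.* j) (i ℤ.* j) (1 ℕ.* m) m {{m*n≢0 1 m}}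
      (cong (λ k → i ℤ.* j ℤ.* + k) (sym (ℕ.*-identityˡ m))))

  i/m≡i*1/m : ∀ i m .{{_ : NonZero m}} → i / m ≡ fromℤ i * (+ 1 / m)
  i/m≡i*1/m i m = sym (trans (fromℤ-*-/ i (+ 1) m) (cong (_/ m) (ℤ.*-identityʳ i)))

  i/m*m≡i : ∀ i m .{{_ : NonZero m}} → (i / m) * fromℕ m ≡ fromℤ i
  i/m*m≡i i m = trans (*-comm (i / m) (fromℕ m)) (trans (fromℤ-*-/ (+ m) i m)
    (i*n≡j*m⇒i/m≡j/n (+ m ℤ.* i) i m 1 (trans (ℤ.*-identityʳ (+ m ℤ.* i)) (ℤ.*-comm (+ m) i))))

module Derivation {c ℓ} (R : CommutativeRing c ℓ) where

  open CommutativeRing R renaming (_*_ to _·_)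

  module Properties
    (θ : Carrier → Carrier)
    (θ-cong : ∀ {x y} → x ≈ y → θ x ≈ θ y)
    (θ-leibniz : ∀ x y → θ (x · y) ≈ θ x · y + x · θ y)
    where

    open import Algebra.Properties.Group +-group using (x≈z//y; //-rightDividesˡ; identityʳ-unique)
    open import Algebra.Solver.Ring.NaturalCoefficients.Default commutativeSemiring
      using (solve; con; _:+_; _:*_; _:=_)
    open import Relation.Binary.Reasoning.Setoid setoid

    θ-1# : θ 1# ≈ 0#
    θ-1# = identityʳ-unique (θ 1#) (θ 1#) (begin
      θ 1# + θ 1#               ≈⟨ +-cong (*-identityʳ (θ 1#)) (*-identityˡ (θ 1#)) ⟨
      θ 1# · 1# + 1# · θ 1#     ≈⟨ θ-leibniz 1# 1# ⟨
      θ (1# · 1#)               ≈⟨ θ-cong (*-identityʳ 1#) ⟩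
      θ 1#                      ∎)

    θ-constant-* : ∀ {κ} x → θ κ ≈ 0# → θ (κ · x) ≈ κ · θ x
    θ-constant-* {κ} x θκ≈0 = begin
      θ (κ · x)             ≈⟨ θ-leibniz κ x ⟩
      θ κ · x + κ · θ x     ≈⟨ +-congʳ (trans (*-congʳ θκ≈0) (zeroˡ x)) ⟩
      0# + κ · θ x          ≈⟨ +-identityˡ (κ · θ x) ⟩
      κ · θ x               ∎

    θ-reciprocal : ∀ {A b} → A · b ≈ 1# → θ b + θ A · (b · b) ≈ 0#
    θ-reciprocal {A} {b} Ab≈1 = begin
      θ b + θ A · (b · b)           ≈⟨ +-congʳ (*-identityʳ (θ b)) ⟨
      θ b · 1# + θ A · (b · b)      ≈⟨ +-congʳ (*-congˡ Ab≈1) ⟨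
      θ b · (A · b) + θ A · (b · b) ≈⟨ solve 4 (λ A b θA θb →
                                         θb :* (A :* b) :+ θA :* (b :* b) := b :* (θA :* b :+ A :* θb))
                                       refl A b (θ A) (θ b) ⟩
      b · (θ A · b + A · θ b)       ≈⟨ *-congˡ (θ-leibniz A b) ⟨
      b · θ (A · b)                 ≈⟨ *-congˡ (trans (θ-cong Ab≈1) θ-1#) ⟩
      b · 0#                        ≈⟨ zeroʳ b ⟩
      0#                            ∎

    infix 8 θ[_]_
    θ[_]_ : Carrier → Carrier → Carrier
    θ[ κ ] x = κ · x - θ x

    module _ {κ A H b c : Carrier}
      (θκ≈0 : θ κ ≈ 0#) (Ab≈1 : A · b ≈ 1#) (Hc≈1 : H · c ≈ 1#)
      (θA+κA≈κH : θ A + κ · A ≈ κ · H)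
      where

      θ[κ]-reciprocal : θ[ κ ] b ≈ κ · (H · (b · b))
      θ[κ]-reciprocal = sym (x≈z//y _ _ _ (begin
        κ · (H · (b · b)) + θ b             ≈⟨ +-congʳ (*-assoc κ H (b · b)) ⟨
        κ · H · (b · b) + θ b               ≈⟨ +-congʳ (*-congʳ θA+κA≈κH) ⟨
        (θ A + κ · A) · (b · b) + θ b       ≈⟨ solve 5 (λ κ A b θA θb →
                                                 (θA :+ κ :* A) :* (b :* b) :+ θb
                                                   := (θb :+ θA :* (b :* b)) :+ κ :* b :* (A :* b))
                                               refl κ A b (θ A) (θ b) ⟩
        (θ b + θ A · (b · b)) + κ · b · (A · b) ≈⟨ +-cong (θ-reciprocal Ab≈1) (*-congˡ Ab≈1) ⟩
        0# + κ · b · 1#                     ≈⟨ solve 2 (λ κ b → con 0 :+ κ :* b :* con 1 := κ :* b) refl κ b ⟩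
        κ · b                               ∎))

      cube-identity : θ[ κ + κ ] (θ[ κ ] b · c) · c ≈ (κ + κ) · (κ · (b · (b · b)))
      cube-identity = begin
        θ[ κ + κ ] P · c                 ≈⟨ *-congʳ θ[2κ]P≈2κb·θ[κ]b ⟩
        (κ + κ) · b · θ[ κ ] b · c       ≈⟨ *-assoc ((κ + κ) · b) (θ[ κ ] b) c ⟩
        (κ + κ) · b · P                  ≈⟨ *-congˡ P≈κb² ⟩
        (κ + κ) · b · (κ · (b · b))      ≈⟨ solve 3 (λ κ₂ κ b →
                                                κ₂ :* b :* (κ :* (b :* b)) := κ₂ :* (κ :* (b :* (b :* b))))
                                              refl (κ + κ) κ b ⟩
        (κ + κ) · (κ · (b · (b · b)))    ∎
        where
        P : Carrier
        P = θ[ κ ] b · c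

        P≈κb² : P ≈ κ · (b · b)
        P≈κb² = begin
          θ[ κ ] b · c                ≈⟨ *-congʳ θ[κ]-reciprocal ⟩
          κ · (H · (b · b)) · c       ≈⟨ solve 4 (λ κ H b c →
                                             κ :* (H :* (b :* b)) :* c := κ :* (b :* b) :* (H :* c))
                                           refl κ H b c ⟩
          κ · (b · b) · (H · c)       ≈⟨ *-congˡ Hc≈1 ⟩
          κ · (b · b) · 1#            ≈⟨ *-identityʳ (κ · (b · b)) ⟩
          κ · (b · b)                 ∎

        θP≈ : θ P ≈ κ · (θ b · b + b · θ b)
        θP≈ = trans (θ-cong P≈κb²) (trans (θ-constant-* (b · b) θκ≈0) (*-congˡ (θ-leibniz b b)))

        θ[2κ]P≈2κb·θ[κ]b : θ[ κ + κ ] P ≈ (κ + κ) · b · θ[ κ ] b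
        θ[2κ]P≈2κb·θ[κ]b = sym (x≈z//y _ _ _ (begin
          (κ + κ) · b · θ[ κ ] b + θ P                       ≈⟨ +-congˡ θP≈ ⟩
          (κ + κ) · b · θ[ κ ] b + κ · (θ b · b + b · θ b)   ≈⟨ solve 4 (λ κ b D θb →
                (κ :+ κ) :* b :* D :+ κ :* (θb :* b :+ b :* θb) := (κ :+ κ) :* b :* (D :+ θb))
              refl κ b (θ[ κ ] b) (θ b) ⟩
          (κ + κ) · b · (θ[ κ ] b + θ b)                     ≈⟨ *-congˡ (//-rightDividesˡ (θ b) (κ · b)) ⟩
          (κ + κ) · b · (κ · b)                              ≈⟨ solve 2 (λ κ b →
                (κ :+ κ) :* b :* (κ :* b) := (κ :+ κ) :* (κ :* (b :* b))) refl κ b ⟩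
          (κ + κ) · (κ · (b · b))                            ≈⟨ *-congˡ P≈κb² ⟨
          (κ + κ) · P                                        ∎))

module PowerSeries where

  open FiniteSums
  open IntegerEmbedding using (fromℕ; fromℕ-homo-+)
  open import Data.Nat as ℕ using (zero; suc; _≤_)
  open import Data.Nat.Properties as ℕ using (m∸[m∸n]≡n; m+[n∸m]≡n)
  open import Data.Rational using (0ℚ; 1ℚ; _+_; -_; _-_)
  open import Data.Rational.Properties
    using ( *-comm; *-assoc; *-identityˡ; *-zeroˡ; *-zeroʳ; *-distribˡ-+; *-distribʳ-+
          ; neg-distribˡ-*; +-identityʳ; +-0-isAbelianGroup)
  open import Data.Rational.Solver using (module +-*-Solver)
  open import Algebra.Construct.Pointwise ℕ using (isAbelianGroup)
  open import Data.Product using (_,_)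
  open import Relation.Binary.PropositionalEquality
  open ≡-Reasoning

  Series : Set
  Series = ℕ → ℚ

  infixl 6 _⊕_
  infixl 7 _⋆_
  infix  8 ⊖_

  _⊕_ : Series → Series → Series
  (f ⊕ g) n = f n + g n

  ⊖_ : Series → Series
  (⊖ f) n = - f n

  𝟘 : Series
  𝟘 _ = 0ℚ

  constant : ℚ → Series
  constant q zero    = q
  constant q (suc _) = 0ℚ

  𝟙 : Series
  𝟙 = constant 1ℚ

  _⋆_ : Series → Series → Series
  (f ⋆ g) n = Σ[≤ n ] (λ k → f k * g (n ∸ k))

  ⋆-cong : ∀ {f f′ g g′} → f ≗ f′ → g ≗ g′ → f ⋆ g ≗ f′ ⋆ g′
  ⋆-cong f≗f′ g≗g′ n = Σ-cong n (λ k → cong₂ _*_ (f≗f′ k) (g≗g′ (n ∸ k)))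

  ⋆-comm : ∀ f g → f ⋆ g ≗ g ⋆ f
  ⋆-comm f g n = begin
    Σ[≤ n ] (λ k → f k * g (n ∸ k))                ≡⟨ Σ-reverse n _ ⟩
    Σ[≤ n ] (λ k → f (n ∸ k) * g (n ∸ (n ∸ k)))    ≡⟨ Σ-cong-≤ n (λ k k≤n →
      trans (cong (λ j → f (n ∸ k) * g j) (m∸[m∸n]≡n k≤n)) (*-comm (f (n ∸ k)) (g k))) ⟩
    Σ[≤ n ] (λ k → g k * f (n ∸ k))                ∎

  ⋆-assoc : ∀ f g h → (f ⋆ g) ⋆ h ≗ f ⋆ (g ⋆ h)
  ⋆-assoc f g h n = begin
    Σ[≤ n ] (λ s → Σ[≤ s ] (λ i → f i * g (s ∸ i)) * h (n ∸ s))
      ≡⟨ Σ-cong n (λ s → *-distribʳ-Σ s (h (n ∸ s)) (λ i → f i * g (s ∸ i))) ⟩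
    Σ[≤ n ] (λ s → Σ[≤ s ] (λ i → f i * g (s ∸ i) * h (n ∸ s)))
      ≡⟨ Σ-triangle n (λ i s → f i * g (s ∸ i) * h (n ∸ s)) ⟩
    Σ[≤ n ] (λ i → Σ[≤ n ∸ i ] (λ j → f i * g (i ℕ.+ j ∸ i) * h (n ∸ (i ℕ.+ j))))
      ≡⟨ Σ-cong n (λ i → Σ-cong (n ∸ i) (λ j →
           trans (cong₂ (λ a b → f i * g a * h b) (ℕ.m+n∸m≡n i j) (sym (ℕ.∸-+-assoc n i j)))
                 (*-assoc (f i) (g j) (h (n ∸ i ∸ j))))) ⟩
    Σ[≤ n ] (λ i → Σ[≤ n ∸ i ] (λ j → f i * (g j * h (n ∸ i ∸ j))))
      ≡⟨ Σ-cong n (λ i → *-distribˡ-Σ (n ∸ i) (f i) (λ j → g j * h (n ∸ i ∸ j))) ⟨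
    Σ[≤ n ] (λ i → f i * Σ[≤ n ∸ i ] (λ j → g j * h (n ∸ i ∸ j))) ∎

  ⋆-distribˡ-⊕ : ∀ f g h → f ⋆ (g ⊕ h) ≗ f ⋆ g ⊕ f ⋆ h
  ⋆-distribˡ-⊕ f g h n =
    trans (Σ-cong n (λ k → *-distribˡ-+ (f k) (g (n ∸ k)) (h (n ∸ k)))) (Σ-distrib-+ n _ _)

  ⋆-distribʳ-⊕ : ∀ f g h → (g ⊕ h) ⋆ f ≗ g ⋆ f ⊕ h ⋆ f
  ⋆-distribʳ-⊕ f g h n = begin
    ((g ⊕ h) ⋆ f) n        ≡⟨ ⋆-comm (g ⊕ h) f n ⟩
    (f ⋆ (g ⊕ h)) n        ≡⟨ ⋆-distribˡ-⊕ f g h n ⟩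
    (f ⋆ g ⊕ f ⋆ h) n      ≡⟨ cong₂ _+_ (⋆-comm f g n) (⋆-comm f h n) ⟩
    (g ⋆ f ⊕ h ⋆ f) n      ∎

  constant-⋆ : ∀ q f → constant q ⋆ f ≗ (λ n → q * f n)
  constant-⋆ q f zero    = refl
  constant-⋆ q f (suc n) = begin
    (constant q ⋆ f) (suc n)
      ≡⟨ Σ-suc n (λ k → constant q k * f (suc n ∸ k)) ⟩
    q * f (suc n) + Σ[≤ n ] (λ k → 0ℚ * f (n ∸ k))
      ≡⟨ cong (q * f (suc n) +_) (trans (Σ-cong n (λ k → *-zeroˡ (f (n ∸ k)))) (Σ-zero n)) ⟩
    q * f (suc n) + 0ℚ
      ≡⟨ +-identityʳ _ ⟩
    q * f (suc n) ∎

  constant-homo-+ : ∀ p q → constant p ⊕ constant q ≗ constant (p + q)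
  constant-homo-+ p q zero    = refl
  constant-homo-+ p q (suc n) = +-identityʳ 0ℚ

  ⋆-identityˡ : ∀ f → 𝟙 ⋆ f ≗ f
  ⋆-identityˡ f n = trans (constant-⋆ 1ℚ f n) (*-identityˡ (f n))

  series-ring : CommutativeRing 0ℓ 0ℓ
  series-ring = record
    { Carrier = Series
    ; _≈_ = _≗_
    ; _+_ = _⊕_
    ; _*_ = _⋆_
    ; -_ = ⊖_
    ; 0# = 𝟘
    ; 1# = 𝟙
    ; isCommutativeRing = record
      { isRing = record
        { +-isAbelianGroup = isAbelianGroup +-0-isAbelianGroup
        ; *-cong = ⋆-cong
        ; *-assoc = ⋆-assoc
        ; *-identity = ⋆-identityˡ , λ f n → trans (⋆-comm f 𝟙 n) (⋆-identityˡ f n)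
        ; distrib = ⋆-distribˡ-⊕ , ⋆-distribʳ-⊕
        }
      ; *-comm = ⋆-comm
      }
    }

  θ : Series → Series
  θ f n = fromℕ n * f n

  θ-cong : ∀ {f g} → f ≗ g → θ f ≗ θ g
  θ-cong f≗g n = cong (fromℕ n *_) (f≗g n)

  θ-leibniz : ∀ f g → θ (f ⋆ g) ≗ θ f ⋆ g ⊕ f ⋆ θ g
  θ-leibniz f g n = begin
    fromℕ n * Σ[≤ n ] (λ k → f k * g (n ∸ k))         ≡⟨ *-distribˡ-Σ n (fromℕ n) _ ⟩
    Σ[≤ n ] (λ k → fromℕ n * (f k * g (n ∸ k)))       ≡⟨ Σ-cong-≤ n split-index ⟩
    Σ[≤ n ] (λ k → fromℕ k * f k * g (n ∸ k) + f k * (fromℕ (n ∸ k) * g (n ∸ k)))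
                                                      ≡⟨ Σ-distrib-+ n _ _ ⟩
    (θ f ⋆ g ⊕ f ⋆ θ g) n                             ∎
    where
    open +-*-Solver
    split-index : ∀ k → k ≤ n →
      fromℕ n * (f k * g (n ∸ k)) ≡ fromℕ k * f k * g (n ∸ k) + f k * (fromℕ (n ∸ k) * g (n ∸ k))
    split-index k k≤n = begin
      fromℕ n * (f k * g (n ∸ k))
        ≡⟨ cong (λ m → fromℕ m * (f k * g (n ∸ k))) (m+[n∸m]≡n k≤n) ⟨
      fromℕ (k ℕ.+ (n ∸ k)) * (f k * g (n ∸ k))
        ≡⟨ cong (_* (f k * g (n ∸ k))) (fromℕ-homo-+ k (n ∸ k)) ⟩
      (fromℕ k + fromℕ (n ∸ k)) * (f k * g (n ∸ k))
        ≡⟨ solve 4 (λ a b x y → (a :+ b) :* (x :* y) := a :* x :* y :+ x :* (b :* y))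
                 refl (fromℕ k) (fromℕ (n ∸ k)) (f k) (g (n ∸ k)) ⟩
      fromℕ k * f k * g (n ∸ k) + f k * (fromℕ (n ∸ k) * g (n ∸ k)) ∎

  θ-constant : ∀ q → θ (constant q) ≗ 𝟘
  θ-constant q zero    = *-zeroˡ q
  θ-constant q (suc n) = *-zeroʳ (fromℕ (suc n))

  open Derivation.Properties series-ring θ θ-cong θ-leibniz public using (θ[_]_; cube-identity)

  θ[]-coefficient : ∀ {κ} q f → κ ⋆ f ≗ (λ n → q * f n) → ∀ n → (θ[ κ ] f) n ≡ (q - fromℕ n) * f n
  θ[]-coefficient {κ} q f κf≗qf n = begin
    (κ ⋆ f) n - fromℕ n * f n        ≡⟨ cong₂ _+_ (κf≗qf n) (neg-distribˡ-* (fromℕ n) (f n)) ⟩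
    q * f n + - fromℕ n * f n        ≡⟨ *-distribʳ-+ (f n) q (- fromℕ n) ⟨
    (q - fromℕ n) * f n              ∎

  θ[]-double-sum : ∀ q f g n →
    (θ[ constant q ⊕ constant q ] (θ[ constant q ] f ⋆ g) ⋆ g) n
      ≡ Σ[≤ n ] (λ m → Σ[≤ m ] (λ k → ((q + q) - fromℕ m) * ((q - fromℕ k) * f k * g (m ∸ k)) * g (n ∸ m)))
  θ[]-double-sum q f g n = Σ-cong n λ m → begin
    (θ[ constant q ⊕ constant q ] P) m * g (n ∸ m)
      ≡⟨ cong (_* g (n ∸ m)) (θ[]-coefficient {constant q ⊕ constant q} (q + q) P 2q⋆P≗[q+q]P m) ⟩
    ((q + q) - fromℕ m) * P m * g (n ∸ m)
      ≡⟨ cong (λ x → ((q + q) - fromℕ m) * x * g (n ∸ m))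
              (Σ-cong m (λ k → cong (_* g (m ∸ k)) (θ[]-coefficient {constant q} q f (constant-⋆ q f) k))) ⟩
    ((q + q) - fromℕ m) * Σ[≤ m ] (λ k → (q - fromℕ k) * f k * g (m ∸ k)) * g (n ∸ m)
      ≡⟨ cong (_* g (n ∸ m)) (*-distribˡ-Σ m ((q + q) - fromℕ m) _) ⟩
    Σ[≤ m ] (λ k → ((q + q) - fromℕ m) * ((q - fromℕ k) * f k * g (m ∸ k))) * g (n ∸ m)
      ≡⟨ *-distribʳ-Σ m (g (n ∸ m)) _ ⟩
    Σ[≤ m ] (λ k → ((q + q) - fromℕ m) * ((q - fromℕ k) * f k * g (m ∸ k)) * g (n ∸ m)) ∎
    where
    P : Series
    P = θ[ constant q ] f ⋆ g
    2q⋆P≗[q+q]P : (constant q ⊕ constant q) ⋆ P ≗ (λ i → (q + q) * P i)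
    2q⋆P≗[q+q]P i = trans (⋆-cong {g = P} (constant-homo-+ q q) (λ _ → refl) i) (constant-⋆ (q + q) P i)

module Reciprocal where

  open FiniteSums
  open PowerSeries using (_⋆_; 𝟙)
  open import Data.Nat as ℕ using (zero; suc)
  import Data.Nat.Properties as ℕ
  open import Data.Rational using (0ℚ; 1ℚ; _+_; -_)
  open import Data.Rational.Properties using (+-identityʳ; +-inverseˡ; *-identityˡ)
  open import Data.List using (List)
  open import Relation.Binary.PropositionalEquality
  open ≡-Reasoning

  -- Defs builds invRev from a private helper; `dot = _` recovers it by unification with
  -- the unfolding of invCoeff, the `with` turning that problem into a pattern.
  private
    mutual
      dot : (ℕ → ℚ) → ℕ → List ℚ → ℚ
      dot = _

      invCoeff-suc : ∀ a n → invCoeff a (suc n) ≡ - dot a 1 (invRev a n)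
      invCoeff-suc a n with 1 | invRev a n
      ... | k | L = refl

    dot-invRev : ∀ a n k → dot a k (invRev a n) ≡ Σ[≤ n ] (λ i → a (k ℕ.+ i) * invCoeff a (n ∸ i))
    dot-invRev a zero    k =
      trans (+-identityʳ (a k * 1ℚ)) (cong (λ j → a j * 1ℚ) (sym (ℕ.+-identityʳ k)))
    dot-invRev a (suc n) k = begin
      a k * invCoeff a (suc n) + dot a (suc k) (invRev a n)
        ≡⟨ cong₂ _+_ (cong (λ j → a j * invCoeff a (suc n)) (sym (ℕ.+-identityʳ k)))
                     (dot-invRev a n (suc k)) ⟩
      a (k ℕ.+ 0) * invCoeff a (suc n) + Σ[≤ n ] (λ i → a (suc k ℕ.+ i) * invCoeff a (n ∸ i))
        ≡⟨ cong (a (k ℕ.+ 0) * invCoeff a (suc n) +_)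
                (Σ-cong n (λ i → cong (λ j → a j * invCoeff a (n ∸ i)) (sym (ℕ.+-suc k i)))) ⟩
      a (k ℕ.+ 0) * invCoeff a (suc n) + Σ[≤ n ] (λ i → a (k ℕ.+ suc i) * invCoeff a (n ∸ i))
        ≡⟨ Σ-suc n (λ i → a (k ℕ.+ i) * invCoeff a (suc n ∸ i)) ⟨
      Σ[≤ suc n ] (λ i → a (k ℕ.+ i) * invCoeff a (suc n ∸ i)) ∎

  invCoeff-inverse : ∀ a → a 0 ≡ 1ℚ → a ⋆ invCoeff a ≗ 𝟙
  invCoeff-inverse a a₀≡1 zero    = trans (cong (_* 1ℚ) a₀≡1) (*-identityˡ 1ℚ)
  invCoeff-inverse a a₀≡1 (suc n) = begin
    Σ[≤ suc n ] (λ k → a k * invCoeff a (suc n ∸ k))   ≡⟨ Σ-suc n _ ⟩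
    a 0 * invCoeff a (suc n) + S                       ≡⟨ cong₂ (λ x y → x * y + S) a₀≡1
                                                            (trans (invCoeff-suc a n) (cong -_ (dot-invRev a n 1))) ⟩
    1ℚ * - S + S                                       ≡⟨ cong (_+ S) (*-identityˡ (- S)) ⟩
    - S + S                                            ≡⟨ +-inverseˡ S ⟩
    0ℚ                                                 ∎
    where
    S : ℚ
    S = Σ[≤ n ] (λ k → a (suc k) * invCoeff a (n ∸ k))

module Hypergeometric where

  open IntegerEmbedding
  open PowerSeries using (_⊕_; _⋆_; constant; θ; constant-⋆)
  open import Data.Nat as ℕ using (suc; _!)
  import Data.Nat.Properties as ℕ
  open import Data.Nat.Solver using (module +-*-Solver)
  open import Data.Integer as ℤ using (+_)
  open import Data.Integer.Properties as ℤ using (pos-*)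
  open import Data.Rational using (1ℚ; _+_; _/_)
  open import Data.Rational.Properties using (*-zeroʳ; *-distribʳ-+)
  open import Data.Bool using (true; false)
  open import Relation.Binary.PropositionalEquality
  open ≡-Reasoning

  hypSeries-constant : ∀ d → hypSeries d 0 ≡ 1ℚ
  hypSeries-constant d = i*n≡j*m⇒i/m≡j/n (+ (d !)) (+ 1) ((d ℕ.+ 0) !) 1 {{(d ℕ.+ 0) ℕ.!≢0}}
    (trans (cong (λ k → + (k !) ℤ.* + 1) (sym (ℕ.+-identityʳ d)))
           (ℤ.*-comm (+ ((d ℕ.+ 0) !)) (+ 1)))

  hypSeries-euler-coeff : ∀ d n →
    fromℕ n * hypSeries (suc d) n + fromℕ (suc d) * hypSeries (suc d) n ≡ fromℕ (suc d) * hypSeries d n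
  hypSeries-euler-coeff d n with isEven n
  ... | false = trans (cong₂ _+_ (*-zeroʳ (fromℕ n)) (*-zeroʳ (fromℕ (suc d)))) (sym (*-zeroʳ (fromℕ (suc d))))
  ... | true  = begin
    fromℕ n * Q₁ + fromℕ (suc d) * Q₁
      ≡⟨ *-distribʳ-+ Q₁ (fromℕ n) (fromℕ (suc d)) ⟨
    (fromℕ n + fromℕ (suc d)) * Q₁
      ≡⟨ cong (_* Q₁) (fromℕ-homo-+ n (suc d)) ⟨
    fromℕ (n ℕ.+ suc d) * Q₁
      ≡⟨ fromℤ-*-/ (+ (n ℕ.+ suc d)) (+ (suc d !)) F₁ {{F₁≢0}} ⟩
    ((+ (n ℕ.+ suc d) ℤ.* + (suc d !)) / F₁) {{F₁≢0}}
      ≡⟨ i*n≡j*m⇒i/m≡j/n (+ (n ℕ.+ suc d) ℤ.* + (suc d !)) (+ suc d ℤ.* + (d !)) F₁ F₀ {{F₁≢0}} {{F₀≢0}}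
                        cross-multiplied ⟩
    ((+ suc d ℤ.* + (d !)) / F₀) {{F₀≢0}}
      ≡⟨ fromℤ-*-/ (+ suc d) (+ (d !)) F₀ {{F₀≢0}} ⟨
    fromℕ (suc d) * Q₀ ∎
    where
    F₀ F₁ : ℕ
    F₀ = (d ℕ.+ n) !
    F₁ = (suc d ℕ.+ n) !
    F₀≢0 : NonZero F₀
    F₀≢0 = (d ℕ.+ n) ℕ.!≢0
    F₁≢0 : NonZero F₁
    F₁≢0 = (suc d ℕ.+ n) ℕ.!≢0
    Q₀ Q₁ : ℚ
    Q₀ = (+ (d !) / F₀) {{F₀≢0}}
    Q₁ = (+ (suc d !) / F₁) {{F₁≢0}}
    open +-*-Solver
    cross-multiplied : + (n ℕ.+ suc d) ℤ.* + (suc d !) ℤ.* + F₀ ≡ + suc d ℤ.* + (d !) ℤ.* + F₁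
    cross-multiplied = begin
      + (n ℕ.+ suc d) ℤ.* + (suc d !) ℤ.* + F₀  ≡⟨ pos-*³ (n ℕ.+ suc d) (suc d !) F₀ ⟩
      + ((n ℕ.+ suc d) ℕ.* (suc d !) ℕ.* F₀)    ≡⟨ cong +_ (solve 4 (λ n d d! F₀ →
           (n :+ (con 1 :+ d)) :* ((con 1 :+ d) :* d!) :* F₀
             := (con 1 :+ d) :* d! :* ((con 1 :+ (d :+ n)) :* F₀)) refl n d (d !) F₀) ⟩
      + (suc d ℕ.* d ! ℕ.* F₁)                  ≡⟨ pos-*³ (suc d) (d !) F₁ ⟨
      + suc d ℤ.* + (d !) ℤ.* + F₁              ∎
      where
      pos-*³ : ∀ a b c → + a ℤ.* + b ℤ.* + c ≡ + (a ℕ.* b ℕ.* c)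
      pos-*³ a b c = sym (trans (pos-* (a ℕ.* b) c) (cong (ℤ._* + c) (pos-* a b)))

  hypSeries-euler : ∀ d →
    θ (hypSeries (suc d)) ⊕ constant (fromℕ (suc d)) ⋆ hypSeries (suc d)
      ≗ constant (fromℕ (suc d)) ⋆ hypSeries d
  hypSeries-euler d n = begin
    fromℕ n * hypSeries (suc d) n + (constant (fromℕ (suc d)) ⋆ hypSeries (suc d)) n
      ≡⟨ cong (λ x → fromℕ n * hypSeries (suc d) n + x)
              (constant-⋆ (fromℕ (suc d)) (hypSeries (suc d)) n) ⟩
    fromℕ n * hypSeries (suc d) n + fromℕ (suc d) * hypSeries (suc d) n
      ≡⟨ hypSeries-euler-coeff d n ⟩
    fromℕ (suc d) * hypSeries d n
      ≡⟨ constant-⋆ (fromℕ (suc d)) (hypSeries d) n ⟨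
    (constant (fromℕ (suc d)) ⋆ hypSeries d) n ∎

module Factorials where

  open IntegerEmbedding using (fromℕ; fromℕ-homo-*)
  open import Data.Nat as ℕ using (_!; _≤_)
  open import Data.Nat.Properties using (_!*_!≢0)
  open import Data.Nat.Combinatorics using (_C_; nCk≡n!/k![n-k]!; k![n∸k]!∣n!)
  open import Data.Nat.DivMod using (m/n*n≡m)
  open import Data.Nat.Solver using (module +-*-Solver)
  open import Relation.Binary.PropositionalEquality
  open ≡-Reasoning

  nCk*k!*[n∸k]!≡n! : ∀ {n k} → k ≤ n → (n C k) ℕ.* (k ! ℕ.* (n ∸ k) !) ≡ n !
  nCk*k!*[n∸k]!≡n! {n} {k} k≤n = trans (cong (ℕ._* (k ! ℕ.* (n ∸ k) !)) (nCk≡n!/k![n-k]! k≤n))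
                                       (m/n*n≡m {{k !* (n ∸ k) !≢0}} (k![n∸k]!∣n! k≤n))

  binomials*factorials : ∀ {n m k} → m ≤ n → k ≤ m →
    fromℕ (n C m) * fromℕ (m C k) * fromℕ (k !) * fromℕ ((n ∸ m) !) * fromℕ ((m ∸ k) !) ≡ fromℕ (n !)
  binomials*factorials {n} {m} {k} m≤n k≤m = begin
    fromℕ (n C m) * fromℕ (m C k) * fromℕ (k !) * fromℕ ((n ∸ m) !) * fromℕ ((m ∸ k) !)
      ≡⟨ fromℕ-homo-*⁵ (n C m) (m C k) (k !) ((n ∸ m) !) ((m ∸ k) !) ⟨
    fromℕ ((n C m) ℕ.* (m C k) ℕ.* k ! ℕ.* (n ∸ m) ! ℕ.* (m ∸ k) !)
      ≡⟨ cong fromℕ (solve 5 (λ a b c d e → a :* b :* c :* d :* e := a :* (b :* (c :* e) :* d))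
                               refl (n C m) (m C k) (k !) ((n ∸ m) !) ((m ∸ k) !)) ⟩
    fromℕ ((n C m) ℕ.* ((m C k) ℕ.* (k ! ℕ.* (m ∸ k) !) ℕ.* (n ∸ m) !))
      ≡⟨ cong (λ x → fromℕ ((n C m) ℕ.* (x ℕ.* (n ∸ m) !))) (nCk*k!*[n∸k]!≡n! k≤m) ⟩
    fromℕ ((n C m) ℕ.* (m ! ℕ.* (n ∸ m) !))
      ≡⟨ cong fromℕ (nCk*k!*[n∸k]!≡n! m≤n) ⟩
    fromℕ (n !) ∎
    where
    open +-*-Solver
    fromℕ-homo-*⁵ : ∀ a b c d e →
      fromℕ (a ℕ.* b ℕ.* c ℕ.* d ℕ.* e) ≡ fromℕ a * fromℕ b * fromℕ c * fromℕ d * fromℕ e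
    fromℕ-homo-*⁵ a b c d e =
      trans (fromℕ-homo-* (a ℕ.* b ℕ.* c ℕ.* d) e) (cong (_* fromℕ e)
      (trans (fromℕ-homo-* (a ℕ.* b ℕ.* c) d) (cong (_* fromℕ d)
      (trans (fromℕ-homo-* (a ℕ.* b) c) (cong (_* fromℕ c) (fromℕ-homo-* a b))))))

module HypergeometricEulerNumbers (N′ : ℕ) where

  open FiniteSums
  open IntegerEmbedding
  open PowerSeries
  open Reciprocal
  open Hypergeometric
  open Factorials
  open import Data.Nat as ℕ using (suc; _!; _≤_)
  import Data.Nat.Properties as ℕ
  open import Data.Nat.Solver using (module +-*-Solver)
  open import Data.Integer as ℤ using (+_)
  open import Data.Rational using (1ℚ; _+_; _-_; _/_)
  open import Data.Rational.Properties using (*-identityˡ)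
  import Data.Rational.Solver as ℚ
  open import Relation.Binary.PropositionalEquality
  open ≡-Reasoning

  N : ℕ
  N = suc N′

  K : ℚ
  K = fromℕ (2 ℕ.* N)

  κ : Series
  κ = constant K

  A H b c : Series
  A = hypSeries (2 ℕ.* N)
  H = hypSeries (suc (2 ℕ.* N′))
  b = invCoeff A
  c = invCoeff H

  1/8N² : ℚ
  1/8N² = + 1 / (8 ℕ.* (N ℕ.* N))

  cube-coefficient : ∀ n → (θ[ κ ⊕ κ ] (θ[ κ ] b ⋆ c) ⋆ c) n ≡ (K + K) * (K * (b ⋆ (b ⋆ b)) n)
  cube-coefficient n = begin
    (θ[ κ ⊕ κ ] (θ[ κ ] b ⋆ c) ⋆ c) n
      ≡⟨ cube-identity {κ} {A} {H} {b} {c} (θ-constant K) Ab≈1 Hc≈1 θA+κA≈κH n ⟩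
    ((κ ⊕ κ) ⋆ (κ ⋆ (b ⋆ (b ⋆ b)))) n
      ≡⟨ ⋆-cong {g = κ ⋆ (b ⋆ (b ⋆ b))} (constant-homo-+ K K) (λ _ → refl) n ⟩
    (constant (K + K) ⋆ (κ ⋆ (b ⋆ (b ⋆ b)))) n
      ≡⟨ constant-⋆ (K + K) (κ ⋆ (b ⋆ (b ⋆ b))) n ⟩
    (K + K) * (κ ⋆ (b ⋆ (b ⋆ b))) n
      ≡⟨ cong ((K + K) *_) (constant-⋆ K (b ⋆ (b ⋆ b)) n) ⟩
    (K + K) * (K * (b ⋆ (b ⋆ b)) n) ∎
    where
    Ab≈1 : A ⋆ b ≗ 𝟙
    Ab≈1 = invCoeff-inverse A (hypSeries-constant (2 ℕ.* N))
    Hc≈1 : H ⋆ c ≗ 𝟙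
    Hc≈1 = invCoeff-inverse H (hypSeries-constant (suc (2 ℕ.* N′)))
    2N≡2+2N′ : 2 ℕ.* N ≡ suc (suc (2 ℕ.* N′))
    2N≡2+2N′ = cong suc (ℕ.+-suc N′ (N′ ℕ.+ 0))
    θA+κA≈κH : θ A ⊕ κ ⋆ A ≗ κ ⋆ H
    θA+κA≈κH = subst (λ D → θ (hypSeries D) ⊕ constant (fromℕ D) ⋆ hypSeries D ≗ constant (fromℕ D) ⋆ H)
                     (sym 2N≡2+2N′) (hypSeries-euler (suc (2 ℕ.* N′)))

  4N≡K+K : fromℕ (4 ℕ.* N) ≡ K + K
  4N≡K+K = trans (cong fromℕ (ℕ.*-distribʳ-+ N 2 2)) (fromℕ-homo-+ (2 ℕ.* N) (2 ℕ.* N))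

  weight≡ : ∀ m k → weight N m k ≡ ((K + K) - fromℕ m) * (K - fromℕ k) * 1/8N²
  weight≡ m k = begin
    weight N m k
      ≡⟨ i/m≡i*1/m ((+ (4 ℕ.* N) ℤ.- + m) ℤ.* (+ (2 ℕ.* N) ℤ.- + k)) (8 ℕ.* (N ℕ.* N)) ⟩
    fromℤ ((+ (4 ℕ.* N) ℤ.- + m) ℤ.* (+ (2 ℕ.* N) ℤ.- + k)) * 1/8N²
      ≡⟨ cong (_* 1/8N²) (fromℤ-homo-* (+ (4 ℕ.* N) ℤ.- + m) (+ (2 ℕ.* N) ℤ.- + k)) ⟩
    fromℤ (+ (4 ℕ.* N) ℤ.- + m) * fromℤ (+ (2 ℕ.* N) ℤ.- + k) * 1/8N²
      ≡⟨ cong₂ (λ x y → x * y * 1/8N²)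
               (trans (fromℤ-homo-- (+ (4 ℕ.* N)) (+ m)) (cong (_- fromℕ m) 4N≡K+K))
               (fromℤ-homo-- (+ (2 ℕ.* N)) (+ k)) ⟩
    ((K + K) - fromℕ m) * (K - fromℕ k) * 1/8N² ∎

  [2N+2N]*2N≡8N² : (2 ℕ.* N ℕ.+ 2 ℕ.* N) ℕ.* (2 ℕ.* N) ≡ 8 ℕ.* (N ℕ.* N)
  [2N+2N]*2N≡8N² = solve 1 (λ n → (con 2 :* n :+ con 2 :* n) :* (con 2 :* n) := con 8 :* (n :* n)) refl N
    where open +-*-Solver

  1/8N²-cancels : ∀ x → 1/8N² * ((K + K) * (K * x)) ≡ x
  1/8N²-cancels x = begin
    1/8N² * ((K + K) * (K * x))
      ≡⟨ solve 4 (λ σ K₂ K x → σ :* (K₂ :* (K :* x)) := σ :* (K₂ :* K) :* x) refl 1/8N² (K + K) K x ⟩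
    1/8N² * ((K + K) * K) * x
      ≡⟨ cong (λ y → 1/8N² * y * x) (trans (fromℕ-homo-* (2 ℕ.* N ℕ.+ 2 ℕ.* N) (2 ℕ.* N))
                                           (cong (_* K) (fromℕ-homo-+ (2 ℕ.* N) (2 ℕ.* N)))) ⟨
    1/8N² * fromℕ ((2 ℕ.* N ℕ.+ 2 ℕ.* N) ℕ.* (2 ℕ.* N)) * x
      ≡⟨ cong (λ n → 1/8N² * fromℕ n * x) [2N+2N]*2N≡8N² ⟩
    1/8N² * fromℕ (8 ℕ.* (N ℕ.* N)) * x
      ≡⟨ cong (_* x) (i/m*m≡i (+ 1) (8 ℕ.* (N ℕ.* N))) ⟩
    1ℚ * x
      ≡⟨ *-identityˡ x ⟩
    x ∎
    where open ℚ.+-*-Solver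

  triple-sum≡ : ∀ n →
    Σ[≤ n ] (λ i → Σ[≤ n ∸ i ] (λ j → multinomial3 n i j (n ∸ i ∸ j) * E N i * E N j * E N (n ∸ i ∸ j)))
      ≡ fromℕ (n !) * (b ⋆ (b ⋆ b)) n
  triple-sum≡ n = begin
    Σ[≤ n ] (λ i → Σ[≤ n ∸ i ] (λ j → multinomial3 n i j (n ∸ i ∸ j) * E N i * E N j * E N (n ∸ i ∸ j)))
      ≡⟨ Σ-cong n (λ i → Σ-cong (n ∸ i) (λ j → term≡ i j (n ∸ i ∸ j))) ⟩
    Σ[≤ n ] (λ i → Σ[≤ n ∸ i ] (λ j → fromℕ (n !) * (b i * (b j * b (n ∸ i ∸ j)))))
      ≡⟨ Σ-cong n (λ i → trans (cong (fromℕ (n !) *_) (*-distribˡ-Σ (n ∸ i) (b i) _))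
                                (*-distribˡ-Σ (n ∸ i) (fromℕ (n !)) _)) ⟨
    Σ[≤ n ] (λ i → fromℕ (n !) * (b i * (b ⋆ b) (n ∸ i)))
      ≡⟨ *-distribˡ-Σ n (fromℕ (n !)) _ ⟨
    fromℕ (n !) * (b ⋆ (b ⋆ b)) n ∎
    where
    open ℚ.+-*-Solver
    term≡ : ∀ i j l → multinomial3 n i j l * E N i * E N j * E N l ≡ fromℕ (n !) * (b i * (b j * b l))
    term≡ i j l = begin
      multinomial3 n i j l * (fromℕ (i !) * b i) * (fromℕ (j !) * b j) * (fromℕ (l !) * b l)
        ≡⟨ solve 7 (λ M i! bᵢ j! bⱼ l! bₗ → M :* (i! :* bᵢ) :* (j! :* bⱼ) :* (l! :* bₗ)
                                           := M :* (i! :* j! :* l!) :* (bᵢ :* (bⱼ :* bₗ)))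
                 refl (multinomial3 n i j l) (fromℕ (i !)) (b i) (fromℕ (j !)) (b j) (fromℕ (l !)) (b l) ⟩
      multinomial3 n i j l * (fromℕ (i !) * fromℕ (j !) * fromℕ (l !)) * (b i * (b j * b l))
        ≡⟨ cong (λ x → multinomial3 n i j l * x * (b i * (b j * b l)))
                (trans (fromℕ-homo-* (i ! ℕ.* j !) (l !)) (cong (_* fromℕ (l !)) (fromℕ-homo-* (i !) (j !)))) ⟨
      multinomial3 n i j l * fromℕ (i ! ℕ.* j ! ℕ.* l !) * (b i * (b j * b l))
        ≡⟨ cong (_* (b i * (b j * b l))) (i/m*m≡i (+ (n !)) (i ! ℕ.* j ! ℕ.* l !) {{i!j!l!≢0}}) ⟩
      fromℕ (n !) * (b i * (b j * b l)) ∎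
      where
      i!j!l!≢0 : NonZero (i ! ℕ.* j ! ℕ.* l !)
      i!j!l!≢0 = ℕ.m*n≢0 (i ! ℕ.* j !) (l !) {{i ℕ.!* j !≢0}} {{l ℕ.!≢0}}

  double-sum≡ : ∀ n →
    Σ[≤ n ] (λ m → Σ[≤ m ] (λ k →
        binomQ n m * binomQ m k * weight N m k * E N k * Ê N′ (n ∸ m) * Ê N′ (m ∸ k)))
      ≡ fromℕ (n !) * 1/8N² * (θ[ κ ⊕ κ ] (θ[ κ ] b ⋆ c) ⋆ c) n
  double-sum≡ n = begin
    Σ[≤ n ] (λ m → Σ[≤ m ] (λ k →
        binomQ n m * binomQ m k * weight N m k * E N k * Ê N′ (n ∸ m) * Ê N′ (m ∸ k)))
      ≡⟨ Σ-cong-≤ n (λ m m≤n → Σ-cong-≤ m (λ k k≤m → term≡ m k m≤n k≤m)) ⟩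
    Σ[≤ n ] (λ m → Σ[≤ m ] (λ k → n!/8N² * T m k))
      ≡⟨ trans (*-distribˡ-Σ n n!/8N² _) (Σ-cong n (λ m → *-distribˡ-Σ m n!/8N² _)) ⟨
    n!/8N² * Σ[≤ n ] (λ m → Σ[≤ m ] (λ k → T m k))
      ≡⟨ cong (n!/8N² *_) (θ[]-double-sum K b c n) ⟨
    n!/8N² * (θ[ κ ⊕ κ ] (θ[ κ ] b ⋆ c) ⋆ c) n ∎
    where
    open ℚ.+-*-Solver
    n!/8N² : ℚ
    n!/8N² = fromℕ (n !) * 1/8N²
    T : ℕ → ℕ → ℚ
    T m k = ((K + K) - fromℕ m) * ((K - fromℕ k) * b k * c (m ∸ k)) * c (n ∸ m)
    term≡ : ∀ m k → m ≤ n → k ≤ m →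
      binomQ n m * binomQ m k * weight N m k * E N k * Ê N′ (n ∸ m) * Ê N′ (m ∸ k) ≡ n!/8N² * T m k
    term≡ m k m≤n k≤m = begin
      binomQ n m * binomQ m k * weight N m k
        * (fromℕ (k !) * b k) * (fromℕ ((n ∸ m) !) * c (n ∸ m)) * (fromℕ ((m ∸ k) !) * c (m ∸ k))
        ≡⟨ cong (λ w → binomQ n m * binomQ m k * w
                         * (fromℕ (k !) * b k) * (fromℕ ((n ∸ m) !) * c (n ∸ m)) * (fromℕ ((m ∸ k) !) * c (m ∸ k)))
                (weight≡ m k) ⟩
      binomQ n m * binomQ m k * (((K + K) - fromℕ m) * (K - fromℕ k) * 1/8N²)
        * (fromℕ (k !) * b k) * (fromℕ ((n ∸ m) !) * c (n ∸ m)) * (fromℕ ((m ∸ k) !) * c (m ∸ k))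
        ≡⟨ solve 11 (λ p q α β σ k! bₖ f₁ c₁ f₂ c₂ →
              p :* q :* (α :* β :* σ) :* (k! :* bₖ) :* (f₁ :* c₁) :* (f₂ :* c₂)
                := p :* q :* k! :* f₁ :* f₂ :* σ :* (α :* (β :* bₖ :* c₂) :* c₁))
            refl (binomQ n m) (binomQ m k) ((K + K) - fromℕ m) (K - fromℕ k) 1/8N²
                 (fromℕ (k !)) (b k) (fromℕ ((n ∸ m) !)) (c (n ∸ m)) (fromℕ ((m ∸ k) !)) (c (m ∸ k)) ⟩
      binomQ n m * binomQ m k * fromℕ (k !) * fromℕ ((n ∸ m) !) * fromℕ ((m ∸ k) !) * 1/8N² * T m k
        ≡⟨ cong (λ x → x * 1/8N² * T m k) (binomials*factorials m≤n k≤m) ⟩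
      n!/8N² * T m k ∎

theorem4 : (N n : ℕ) → .{{_ : NonZero N}} →
    Σ[≤ n ] (λ i₁ → Σ[≤ n ∸ i₁ ] (λ i₂ →
        multinomial3 n i₁ i₂ (n ∸ i₁ ∸ i₂)
          * E N i₁ * E N i₂ * E N (n ∸ i₁ ∸ i₂)))
      ≡
    Σ[≤ n ] (λ m → Σ[≤ m ] (λ k →
        binomQ n m * binomQ m k * weight N m k
          * E N k * Ê (N ∸ 1) (n ∸ m) * Ê (N ∸ 1) (m ∸ k)))
theorem4 (suc N′) n = begin
  _                                                          ≡⟨ triple-sum≡ n ⟩
  fromℕ (n !) * (b ⋆ (b ⋆ b)) n                              ≡⟨ cong (fromℕ (n !) *_) (1/8N²-cancels _) ⟨
  fromℕ (n !) * (1/8N² * ((K + K) * (K * (b ⋆ (b ⋆ b)) n)))  ≡⟨ *-assoc (fromℕ (n !)) 1/8N² _ ⟨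
  fromℕ (n !) * 1/8N² * ((K + K) * (K * (b ⋆ (b ⋆ b)) n))    ≡⟨ cong (fromℕ (n !) * 1/8N² *_) (cube-coefficient n) ⟨
  fromℕ (n !) * 1/8N² * (θ[ κ ⊕ κ ] (θ[ κ ] b ⋆ c) ⋆ c) n    ≡⟨ double-sum≡ n ⟨
  _                                                          ∎
  where
  open ≡-Reasoning
  open IntegerEmbedding using (fromℕ)
  open PowerSeries using (_⋆_; _⊕_; θ[_]_)
  open HypergeometricEulerNumbers N′
  open import Data.Rational using (_+_)
  open import Data.Rational.Properties using (*-assoc)
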